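{- Let $s,k\in\mathbb{N}$ and let $G$ and $H$ be graphs. If $G \equiv_{C_{8k}} H$, then $G^{s} \equiv_{C_{k}} H^{s}$.
   Context: All graphs are finite and simple. For a positive integer $m$, $C_m$ denotes the $m$-variable fragment of first-order logic with counting quantifiers over the signature of graphs; $G\equiv_{C_m}H$ means $G$ and $H$ satisfy the same $C_m$-sentences. For $s\in\mathbb{N}$, the $s$-subdivision $G^s$ is obtained from $G$ by replacing every edge by a path of length $s+1$. -}

module Defs where

open import Data.Nat using (ℕ; zero; suc; _+_; _*_; _<ᵇ_; _≡ᵇ_; _≤ᵇ_)
open import Data.Bool using (Bool; true; false; _∧_; _∨_; not)
open import Data.Fin using (Fin; toℕ; splitAt; remQuot)
open import Data.Fin as Fin using ()
open import Data.Maybe using (Maybe; just; nothing)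
open import Data.List using (List; length; filterᵇ; lookup; allFin; cartesianProduct)
open import Data.Product using (_×_; _,_; proj₁; proj₂)
open import Data.Sum using (_⊎_; inj₁; inj₂)
open import Relation.Nullary using (does)
open import Relation.Binary.PropositionalEquality using (_≡_)

record Graph : Set where
  field
    n   : ℕ
    adj : Fin n → Fin n → Bool
open Graph public

record IsSimple (G : Graph) : Set where
  field
    symmetric   : ∀ u v → adj G u v ≡ adj G v u
    irreflexive : ∀ u → adj G u u ≡ false

_==_ : ∀ {n} → Fin n → Fin n → Bool
i == j = does (i Fin.≟ j)

-- G^s has vertex set  Fin n ⊎ (Fin |E| × Fin s)  (encoded as
-- Fin (n + |E| * s)); edge e = (u , v) becomes the path
-- u — (e,0) — (e,1) — … — (e,s-1) — v  (and stays the edge u — v if s = 0).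

edges : (G : Graph) → List (Fin (n G) × Fin (n G))
edges G = filterᵇ (λ p → (toℕ (proj₁ p) <ᵇ toℕ (proj₂ p)) ∧ adj G (proj₁ p) (proj₂ p))
                  (cartesianProduct (allFin (n G)) (allFin (n G)))

numEdges : Graph → ℕ
numEdges G = length (edges G)

endAdj : (G : Graph) (s : ℕ) → Fin (n G) → Fin (numEdges G) → Fin s → Bool
endAdj G s u e i =
  ((toℕ i ≡ᵇ 0) ∧ (u == proj₁ (lookup (edges G) e)))
  ∨ ((suc (toℕ i) ≡ᵇ s) ∧ (u == proj₂ (lookup (edges G) e)))

decode : (G : Graph) (s : ℕ) → Fin (n G + numEdges G * s) → Fin (n G) ⊎ (Fin (numEdges G) × Fin s)
decode G s x with splitAt (n G) x
... | inj₁ u = inj₁ u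
... | inj₂ y = inj₂ (remQuot s y)

subAdj : (G : Graph) (s : ℕ) → Fin (n G) ⊎ (Fin (numEdges G) × Fin s) → Fin (n G) ⊎ (Fin (numEdges G) × Fin s) → Bool
subAdj G zero    (inj₁ u) (inj₁ v) = adj G u v
subAdj G (suc s) (inj₁ u) (inj₁ v) = false
subAdj G s (inj₁ u) (inj₂ (e , i)) = endAdj G s u e i
subAdj G s (inj₂ (e , i)) (inj₁ u) = endAdj G s u e i
subAdj G s (inj₂ (e , i)) (inj₂ (f , j)) =
  (e == f) ∧ ((suc (toℕ i) ≡ᵇ toℕ j) ∨ (suc (toℕ j) ≡ᵇ toℕ i))

subdivision : Graph → ℕ → Graph
subdivision G s = record
  { n   = n G + numEdges G * s
  ; adj = λ x y → subAdj G s (decode G s x) (decode G s y)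
  }

-- The counting logic C_m: first-order logic with counting quantifiers
-- ∃^{≥t}, using only the m variables x_0,…,x_{m-1} (reusable).

data Formula (m : ℕ) : Set where
  eqᶠ   : Fin m → Fin m → Formula m
  edgeᶠ : Fin m → Fin m → Formula m
  ¬ᶠ    : Formula m → Formula m
  _∧ᶠ_  : Formula m → Formula m → Formula m
  ∃≥    : ℕ → Fin m → Formula m → Formula m

free : ∀ {m} → Fin m → Formula m → Bool
free x (eqᶠ y z)   = (x == y) ∨ (x == z)
free x (edgeᶠ y z) = (x == y) ∨ (x == z)
free x (¬ᶠ φ)      = free x φ
free x (φ ∧ᶠ ψ)    = free x φ ∨ free x ψ
free x (∃≥ t y φ)  = not (x == y) ∧ free x φ

Sentence : ∀ {m} → Formula m → Set
Sentence φ = ∀ x → free x φ ≡ false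

-- partial assignments (unassigned variables only occur in non-sentences)
Assignment : ℕ → Graph → Set
Assignment m G = Fin m → Maybe (Fin (n G))

_[_↦_] : ∀ {m G} → Assignment m G → Fin m → Fin (n G) → Assignment m G
(_[_↦_] {G = G} a x v) y = if′ (y == x) (just v) (a y)
  where
  if′ : ∀ {A : Set} → Bool → A → A → A
  if′ true  p q = p
  if′ false p q = q

eqM : ∀ {k} → Maybe (Fin k) → Maybe (Fin k) → Bool
eqM (just u) (just v) = u == v
eqM _ _ = false

adjM : (G : Graph) → Maybe (Fin (n G)) → Maybe (Fin (n G)) → Bool
adjM G (just u) (just v) = adj G u v
adjM G _ _ = false

⟦_⟧ : ∀ {m} → Formula m → (G : Graph) → Assignment m G → Bool
⟦ eqᶠ x y   ⟧ G a = eqM (a x) (a y)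
⟦ edgeᶠ x y ⟧ G a = adjM G (a x) (a y)
⟦ ¬ᶠ φ      ⟧ G a = not (⟦ φ ⟧ G a)
⟦ φ ∧ᶠ ψ    ⟧ G a = ⟦ φ ⟧ G a ∧ ⟦ ψ ⟧ G a
⟦ ∃≥ t x φ  ⟧ G a = t ≤ᵇ length (filterᵇ (λ v → ⟦ φ ⟧ G (_[_↦_] {G = G} a x v)) (allFin (n G)))

emptyAssignment : ∀ {m} (G : Graph) → Assignment m G
emptyAssignment G _ = nothing

_⊨_ : ∀ {m} → Graph → Formula m → Bool
infix 4 _⊨_
G ⊨ φ = ⟦ φ ⟧ G (emptyAssignment G)

C-equiv : ℕ → Graph → Graph → Set
C-equiv m G H = (φ : Formula m) → Sentence φ → (G ⊨ φ) ≡ (H ⊨ φ)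

module Submission where

-- A C_k-formula about Gˢ is translated into a C_{8k}-sentence about G with the same truth value,
-- so C_{8k}-equivalent graphs have C_k-equivalent subdivisions.  A variable x ranging over Gˢ is
-- simulated by two variables p x, q x ranging over G: a branch vertex u by p x = u, and the inner
-- vertex at position i on the subdivided edge from a to b by (p x, q x) = (a, b); the kind of x
-- (branch, or inner at position i) is fixed by the translation, which branches over all kinds at
-- every quantifier.  The same inner vertex is also represented by (b, a) at position s-1-i, so the
-- Gˢ-witnesses of ∃^{≥t} x number at least t iff twice the branch witnesses plus the ordered
-- adjacent pairs (a, b) witnessing some inner position number at least 2t.  Sums of counts and
-- counts of pairs are expressible with counting quantifiers over p x and q x alone, so 2k
-- variables suffice.

open import Defs
open import Data.Bool using (Bool; true; false; T; not; _∧_; _∨_; if_then_else_)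
open import Data.Bool.Properties using (T-≡; T-∧; T-∨; ⇔→≡; ∧-zeroʳ; ∨-comm; not-involutive)
open import Data.Empty using (⊥; ⊥-elim)
open import Data.Fin as Fin using (Fin; zero; suc; toℕ; opposite; _↑ˡ_; _↑ʳ_; combine; splitAt; remQuot)
open import Data.Fin.Properties
  using (toℕ-injective; toℕ<n; opposite-prop; opposite-involutive; splitAt-↑ˡ; splitAt-↑ʳ; remQuot-combine;
         ↑ˡ-injective; ↑ʳ-injective; combine-injective)
import Data.Fin.Permutation as Perm
open import Data.List
  using (List; []; _∷_; _++_; length; lookup; map; filterᵇ; tabulate; cartesianProduct; allFin)
open import Data.List.Properties using (map-++; map-∘; map-tabulate)
open import Data.List.Membership.Propositional.Properties using (∈-lookup)
open import Data.List.Relation.Binary.Pointwise as Pointwise using (Pointwise; []; _∷_)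
open import Data.List.Relation.Unary.All as All using (All; []; _∷_)
open import Data.List.Relation.Unary.All.Properties as Allₚ using (all-filter)
open import Data.List.Relation.Unary.AllPairs using (_∷_)
open import Data.List.Relation.Unary.Unique.Propositional using (Unique)
import Data.List.Relation.Unary.Unique.Propositional.Properties as Unique
open import Data.Maybe using (Maybe; just; nothing)
open import Data.Maybe.Properties using (just-injective)
open import Data.Nat using (ℕ; zero; suc; _+_; _*_; _∸_; _≤_; _<_; z≤n; _⊓_; _≤ᵇ_; _<ᵇ_; _≡ᵇ_)
open import Data.Nat.ListAction using () renaming (sum to sumᴸ)
open import Data.Nat.ListAction.Properties using () renaming (sum-++ to sumᴸ-++)
open import Data.Nat.Properties
  using (+-assoc; +-identityʳ; +-suc; +-mono-≤; +-monoʳ-≤; +-cancelʳ-≤; +-cancelʳ-≡; ≤-refl; ≤-trans; ≤-reflexive;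
         ≤-total; ≤-pred; m≤n⇒m≤1+n; m≤n⇒m<n∨m≡n; m⊓n≤m; m⊓n≤n; m≥n⇒m⊓n≡n; m≤n⇒m⊓n≡m; m≤m+n; m≤n+m;
         ⊓-zeroʳ; n∸n≡0; m∸n+n≡m; m≤n+o⇒m∸n≤o; m≤n+m∸n; ≤ᵇ⇒≤; ≤⇒≤ᵇ; ≡ᵇ⇒≡; ≡⇒≡ᵇ; <ᵇ⇒<; <-cmp; <-asym;
         _<?_; +-0-commutativeMonoid; +-commutativeSemigroup)
open import Data.Product using (_×_; _,_; proj₁; proj₂; ∃-syntax)
open import Data.Product.Function.NonDependent.Propositional using (_×-⇔_)
open import Data.Product.Properties using (,-injective)
open import Data.Sum as Sum using (_⊎_; inj₁; inj₂; [_,_]′)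
open import Data.Sum.Function.Propositional using (_⊎-⇔_)
open import Data.Vec.Functional using (updateAt)
open import Data.Vec.Functional.Properties using (updateAt-updates; updateAt-minimal)
open import Function using (_∘_; id; const; _⇔_; mk⇔; Equivalence)
import Function.Properties.Equivalence as ⇔
open import Relation.Binary using (tri<; tri≈; tri>)
open import Relation.Binary.PropositionalEquality
  using (_≡_; _≢_; refl; sym; trans; cong; cong₂; subst; module ≡-Reasoning)
open import Relation.Nullary using (¬_; yes; no)
open import Relation.Nullary.Decidable using (T?; dec-true; dec-false)
open import Relation.Nullary.Negation using (contradiction)
open import Algebra.Properties.CommutativeMonoid.Sum +-0-commutativeMonoid
  using (sum; sum-syntax; sum-cong-≗; ∑-distrib-+; ∑-comm; sum-permute; sum-replicate-zero)
open import Algebra.Properties.CommutativeSemigroup +-commutativeSemigroup using (interchange)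

open Equivalence using (to; from)

T-ext : ∀ {a b} → (T a ⇔ T b) → a ≡ b
T-ext h = ⇔→≡ (⇔.trans (⇔.sym T-≡) (⇔.trans h T-≡))

T-== : ∀ {n} {i j : Fin n} → T (i == j) ⇔ i ≡ j
T-== {i = i} {j} with i Fin.≟ j
... | yes i≡j = mk⇔ (λ _ → i≡j) _
... | no  i≢j = mk⇔ (λ ()) i≢j

T-not-==⇒≢ : ∀ {n} {i j : Fin n} → T (not (i == j)) → i ≢ j
T-not-==⇒≢ {i = i} {j} h i≡j = subst (T ∘ not) (dec-true (i Fin.≟ j) i≡j) h

T-≡ᵇ : ∀ {m n} → T (m ≡ᵇ n) ⇔ m ≡ n
T-≡ᵇ = mk⇔ (≡ᵇ⇒≡ _ _) (≡⇒≡ᵇ _ _)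

T-≤ᵇ : ∀ {m n} → T (m ≤ᵇ n) ⇔ m ≤ n
T-≤ᵇ = mk⇔ (≤ᵇ⇒≤ _ _) ≤⇒≤ᵇ

T-oriented : ∀ {n} {c c′ : Bool} {P P′ : Set} {a b a′ b′ : Fin n} → T c ⇔ P → T c′ ⇔ P′ →
  T ((c ∧ ((a == a′) ∧ (b == b′))) ∨ (c′ ∧ ((a == b′) ∧ (b == a′)))) ⇔
  ((P × a ≡ a′ × b ≡ b′) ⊎ (P′ × a ≡ b′ × b ≡ a′))
T-oriented c⇔P c′⇔P′ = ⇔.trans T-∨ (guarded c⇔P ⊎-⇔ guarded c′⇔P′)
  where
  guarded : ∀ {c P} {a b a′ b′ : Fin _} → T c ⇔ P → T (c ∧ ((a == a′) ∧ (b == b′))) ⇔ (P × a ≡ a′ × b ≡ b′)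
  guarded c⇔P = ⇔.trans T-∧ (c⇔P ×-⇔ ⇔.trans T-∧ (T-== ×-⇔ T-==))

-- Finite sums and counting

indicator : Bool → ℕ
indicator b = if b then 1 else 0

count : ∀ {n} → (Fin n → Bool) → ℕ
count {n} P = ∑[ i < n ] indicator (P i)

length-filterᵇ-tabulate : ∀ {A : Set} {n} (P : A → Bool) (f : Fin n → A) →
  length (filterᵇ P (tabulate f)) ≡ count (P ∘ f)
length-filterᵇ-tabulate {n = zero} P f = refl
length-filterᵇ-tabulate {n = suc n} P f with P (f zero)
... | true  = cong suc (length-filterᵇ-tabulate P (f ∘ suc))
... | false = length-filterᵇ-tabulate P (f ∘ suc)

∑-↑ : ∀ m {n} (f : Fin (m + n) → ℕ) → sum f ≡ ∑[ i < m ] f (i ↑ˡ n) + ∑[ j < n ] f (m ↑ʳ j)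
∑-↑ zero    f = refl
∑-↑ (suc m) f = trans (cong (f zero +_) (∑-↑ m (f ∘ suc))) (sym (+-assoc (f zero) _ _))

∑-combine : ∀ m {n} (f : Fin (m * n) → ℕ) → sum f ≡ ∑[ i < m ] ∑[ j < n ] f (combine i j)
∑-combine zero        f = refl
∑-combine (suc m) {n} f =
  trans (∑-↑ n f) (cong (∑[ j < n ] f (j ↑ˡ (m * n)) +_) (∑-combine m (f ∘ (n ↑ʳ_))))

∑-opposite : ∀ {n} (f : Fin n → ℕ) → ∑[ i < n ] f (opposite i) ≡ sum f
∑-opposite f = sym (sum-permute f Perm.reverse)

∑-mono-≤ : ∀ {n} {f g : Fin n → ℕ} → (∀ i → f i ≤ g i) → sum f ≤ sum g
∑-mono-≤ {zero}  f≤g = ≤-refl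
∑-mono-≤ {suc n} f≤g = +-mono-≤ (f≤g zero) (∑-mono-≤ (f≤g ∘ suc))

⊓-subadditive : ∀ x y c → (x + y) ⊓ c ≤ x ⊓ c + y ⊓ c
⊓-subadditive x y c with ≤-total c x | ≤-total c y
... | inj₁ c≤x | _        = ≤-trans (m⊓n≤n (x + y) c) (subst (_≤ x ⊓ c + y ⊓ c) (m≥n⇒m⊓n≡n c≤x) (m≤m+n _ _))
... | inj₂ _   | inj₁ c≤y = ≤-trans (m⊓n≤n (x + y) c) (subst (_≤ x ⊓ c + y ⊓ c) (m≥n⇒m⊓n≡n c≤y) (m≤n+m _ _))
... | inj₂ x≤c | inj₂ y≤c =
  subst ((x + y) ⊓ c ≤_) (sym (cong₂ _+_ (m≤n⇒m⊓n≡m x≤c) (m≤n⇒m⊓n≡m y≤c))) (m⊓n≤m (x + y) c)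

∑-⊓ : ∀ {n} (f : Fin n → ℕ) c → sum f ⊓ c ≤ ∑[ i < n ] (f i ⊓ c)
∑-⊓ {zero}  f c = ≤-refl
∑-⊓ {suc n} f c = ≤-trans (⊓-subadditive (f zero) _ c) (+-monoʳ-≤ (f zero ⊓ c) (∑-⊓ (f ∘ suc) c))

≤-∑-⊓ : ∀ {n} (f : Fin n → ℕ) c → c ≤ ∑[ i < n ] (f i ⊓ c) ⇔ c ≤ sum f
≤-∑-⊓ f c = mk⇔ (λ c≤ → ≤-trans c≤ (∑-mono-≤ (λ i → m⊓n≤m (f i) c)))
                (λ c≤ → ≤-trans (≤-reflexive (sym (m≥n⇒m⊓n≡n c≤))) (∑-⊓ f c))

∑-threshold : ∀ c y → ∑[ j < c ] indicator (suc (toℕ j) ≤ᵇ y) ≡ y ⊓ c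
∑-threshold zero    y       = sym (⊓-zeroʳ y)
∑-threshold (suc c) zero    = sum-replicate-zero c
∑-threshold (suc c) (suc y) = cong suc (∑-threshold c y)

∑-layers : ∀ {n} c (f : Fin n → ℕ) →
  ∑[ j < c ] count (λ a → suc (toℕ j) ≤ᵇ f a) ≡ ∑[ a < n ] (f a ⊓ c)
∑-layers {n} c f =
  trans (∑-comm {c} {n} (λ j a → indicator (suc (toℕ j) ≤ᵇ f a))) (sum-cong-≗ (λ a → ∑-threshold c (f a)))

≤-+⇔split : ∀ t n r → t ≤ n + r ⇔ (∃[ c ] (c ≤ t × c ≤ n × t ∸ c ≤ r))
≤-+⇔split t n r = mk⇔ split join
  where
  split : t ≤ n + r → ∃[ c ] (c ≤ t × c ≤ n × t ∸ c ≤ r)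
  split t≤n+r with ≤-total t n
  ... | inj₁ t≤n = t , ≤-refl , t≤n , subst (_≤ r) (sym (n∸n≡0 t)) z≤n
  ... | inj₂ n≤t = n , n≤t , ≤-refl , m≤n+o⇒m∸n≤o t n t≤n+r
  join : ∃[ c ] (c ≤ t × c ≤ n × t ∸ c ≤ r) → t ≤ n + r
  join (c , _ , c≤n , t∸c≤r) = ≤-trans (m≤n+m∸n t c) (+-mono-≤ c≤n t∸c≤r)

≤ᵇ-double : ∀ t n → (t + t ≤ᵇ n + n) ≡ (t ≤ᵇ n)
≤ᵇ-double t n = T-ext (⇔.trans T-≤ᵇ (⇔.trans (mk⇔ halve (λ t≤n → +-mono-≤ t≤n t≤n)) (⇔.sym T-≤ᵇ)))
  where
  halve : t + t ≤ n + n → t ≤ n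
  halve 2t≤2n with ≤-total t n
  ... | inj₁ t≤n = t≤n
  ... | inj₂ n≤t = +-cancelʳ-≤ t t n (≤-trans 2t≤2n (+-monoʳ-≤ n n≤t))

-- Positions on a path

opposite-injective : ∀ {n} {i j : Fin n} → opposite i ≡ opposite j → i ≡ j
opposite-injective {i = i} {j} eq =
  trans (sym (opposite-involutive i)) (trans (cong opposite eq) (opposite-involutive j))

toℕ-opposite-+ : ∀ {n} (i : Fin n) → toℕ (opposite i) + suc (toℕ i) ≡ n
toℕ-opposite-+ i = trans (cong (_+ suc (toℕ i)) (opposite-prop i)) (m∸n+n≡m (toℕ<n i))

opposite-first : ∀ {n} (i : Fin n) → (toℕ (opposite i) ≡ᵇ 0) ≡ (suc (toℕ i) ≡ᵇ n)
opposite-first {n} i = T-ext (⇔.trans T-≡ᵇ (⇔.trans (mk⇔ first⇒last last⇒first) (⇔.sym T-≡ᵇ)))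
  where
  first⇒last : toℕ (opposite i) ≡ 0 → suc (toℕ i) ≡ n
  first⇒last o≡0 = trans (cong (_+ suc (toℕ i)) (sym o≡0)) (toℕ-opposite-+ i)
  last⇒first : suc (toℕ i) ≡ n → toℕ (opposite i) ≡ 0
  last⇒first 1+i≡n = +-cancelʳ-≡ (suc (toℕ i)) _ 0 (trans (toℕ-opposite-+ i) (sym 1+i≡n))

opposite-last : ∀ {n} (i : Fin n) → (suc (toℕ (opposite i)) ≡ᵇ n) ≡ (toℕ i ≡ᵇ 0)
opposite-last i =
  trans (sym (opposite-first (opposite i))) (cong (λ j → toℕ j ≡ᵇ 0) (opposite-involutive i))

Adjacent : ∀ {n} → Fin n → Fin n → Set
Adjacent i j = suc (toℕ i) ≡ toℕ j ⊎ suc (toℕ j) ≡ toℕ i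

adjacentᵇ : ∀ {n} → Fin n → Fin n → Bool
adjacentᵇ i j = (suc (toℕ i) ≡ᵇ toℕ j) ∨ (suc (toℕ j) ≡ᵇ toℕ i)

T-adjacent : ∀ {n} {i j : Fin n} → T (adjacentᵇ i j) ⇔ Adjacent i j
T-adjacent = ⇔.trans T-∨ (T-≡ᵇ ⊎-⇔ T-≡ᵇ)

adjacent-opposite : ∀ {n} {i j : Fin n} → Adjacent i j → Adjacent (opposite i) (opposite j)
adjacent-opposite {i = i} {j} = Sum.swap ∘ Sum.map (step i j) (step j i)
  where
  step : ∀ i j → suc (toℕ i) ≡ toℕ j → suc (toℕ (opposite j)) ≡ toℕ (opposite i)
  step i j 1+i≡j = +-cancelʳ-≡ (suc (toℕ i)) _ _ (begin
    suc (toℕ (opposite j)) + suc (toℕ i)   ≡⟨ sym (+-suc _ (suc (toℕ i))) ⟩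
    toℕ (opposite j) + suc (suc (toℕ i))   ≡⟨ cong (λ x → toℕ (opposite j) + suc x) 1+i≡j ⟩
    toℕ (opposite j) + suc (toℕ j)         ≡⟨ toℕ-opposite-+ j ⟩
    _                                      ≡⟨ sym (toℕ-opposite-+ i) ⟩
    toℕ (opposite i) + suc (toℕ i)         ∎)
    where open ≡-Reasoning

adjacent-opposite-swap : ∀ {n} {i j : Fin n} → Adjacent i (opposite j) → Adjacent (opposite i) j
adjacent-opposite-swap {j = j} adj = subst (Adjacent _) (opposite-involutive j) (adjacent-opposite adj)

↑ˡ≢↑ʳ : ∀ {m n} (i : Fin m) (j : Fin n) → i ↑ˡ n ≢ m ↑ʳ j
↑ˡ≢↑ʳ {m} {n} i j eq
  with () ← trans (sym (splitAt-↑ˡ m i n)) (trans (cong (splitAt m) eq) (splitAt-↑ʳ m n j))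

-- Edges of a simple graph

lookup-injective : ∀ {A : Set} {xs : List A} → Unique xs → ∀ {i j} → lookup xs i ≡ lookup xs j → i ≡ j
lookup-injective (_  ∷ _)   {zero}  {zero}  _  = refl
lookup-injective (x∉ ∷ _)   {zero}  {suc j} eq = contradiction eq (All.lookup x∉ (∈-lookup j))
lookup-injective (x∉ ∷ _)   {suc i} {zero}  eq = contradiction (sym eq) (All.lookup x∉ (∈-lookup i))
lookup-injective (_  ∷ xs!) {suc i} {suc j} eq = cong suc (lookup-injective xs! eq)

sumᴸ-map-lookup : ∀ {A : Set} (f : A → ℕ) xs → ∑[ i < length xs ] f (lookup xs i) ≡ sumᴸ (map f xs)
sumᴸ-map-lookup f []       = refl
sumᴸ-map-lookup f (x ∷ xs) = cong (f x +_) (sumᴸ-map-lookup f xs)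

sumᴸ-tabulate : ∀ {n} (f : Fin n → ℕ) → sumᴸ (tabulate f) ≡ sum f
sumᴸ-tabulate {zero}  f = refl
sumᴸ-tabulate {suc n} f = cong (f zero +_) (sumᴸ-tabulate (f ∘ suc))

sumᴸ-map-allFin : ∀ {n} (f : Fin n → ℕ) → sumᴸ (map f (allFin n)) ≡ sum f
sumᴸ-map-allFin f = trans (cong sumᴸ (map-tabulate id f)) (sumᴸ-tabulate f)

sumᴸ-map-filterᵇ : ∀ {A : Set} (C F : A → Bool) xs →
  sumᴸ (map (indicator ∘ F) (filterᵇ C xs)) ≡ sumᴸ (map (λ x → indicator (C x ∧ F x)) xs)
sumᴸ-map-filterᵇ C F []       = refl
sumᴸ-map-filterᵇ C F (x ∷ xs) with C x
... | true  = cong (indicator (F x) +_) (sumᴸ-map-filterᵇ C F xs)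
... | false = sumᴸ-map-filterᵇ C F xs

sumᴸ-map-cartesianProduct : ∀ {A B : Set} (f : A × B → ℕ) xs ys →
  sumᴸ (map f (cartesianProduct xs ys)) ≡ sumᴸ (map (λ x → sumᴸ (map (λ y → f (x , y)) ys)) xs)
sumᴸ-map-cartesianProduct f []       ys = refl
sumᴸ-map-cartesianProduct f (x ∷ xs) ys = begin
  sumᴸ (map f (map (x ,_) ys ++ cartesianProduct xs ys))
    ≡⟨ cong sumᴸ (map-++ f (map (x ,_) ys) _) ⟩
  sumᴸ (map f (map (x ,_) ys) ++ map f (cartesianProduct xs ys))
    ≡⟨ sumᴸ-++ (map f (map (x ,_) ys)) _ ⟩
  sumᴸ (map f (map (x ,_) ys)) + sumᴸ (map f (cartesianProduct xs ys))
    ≡⟨ cong₂ _+_ (cong sumᴸ (sym (map-∘ ys))) (sumᴸ-map-cartesianProduct f xs ys) ⟩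
  sumᴸ (map (λ y → f (x , y)) ys) + sumᴸ (map (λ x → sumᴸ (map (λ y → f (x , y)) ys)) xs)
    ∎
  where open ≡-Reasoning

module Edges (G : Graph) (simple : IsSimple G) where
  open IsSimple simple

  N E : ℕ
  N = n G
  E = numEdges G

  -- The predicate by which Defs.edges selects its vertex pairs.
  orderedEdge : Fin N × Fin N → Bool
  orderedEdge p = (toℕ (proj₁ p) <ᵇ toℕ (proj₂ p)) ∧ adj G (proj₁ p) (proj₂ p)

  edge : Fin E → Fin N × Fin N
  edge = lookup (edges G)

  vertexPairs : List (Fin N × Fin N)
  vertexPairs = cartesianProduct (allFin N) (allFin N)

  edge-injective : ∀ {e e′} → edge e ≡ edge e′ → e ≡ e′
  edge-injective = lookup-injective
    (Unique.filter⁺ (T? ∘ orderedEdge) (Unique.cartesianProduct⁺ (Unique.allFin⁺ N) (Unique.allFin⁺ N)))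

  edge-ordered : ∀ e → toℕ (proj₁ (edge e)) < toℕ (proj₂ (edge e))
  edge-ordered e =
    <ᵇ⇒< _ _ (proj₁ (to T-∧ (All.lookup (all-filter (T? ∘ orderedEdge) vertexPairs) (∈-lookup e))))

  ∑-edge : ∀ (F : Fin N × Fin N → Bool) →
    count (F ∘ edge) ≡ ∑[ a < N ] count (λ b → orderedEdge (a , b) ∧ F (a , b))
  ∑-edge F = begin
    count (F ∘ edge)
      ≡⟨ sumᴸ-map-lookup (indicator ∘ F) (edges G) ⟩
    sumᴸ (map (indicator ∘ F) (edges G))
      ≡⟨ sumᴸ-map-filterᵇ orderedEdge F vertexPairs ⟩
    sumᴸ (map χ vertexPairs)
      ≡⟨ sumᴸ-map-cartesianProduct χ (allFin N) (allFin N) ⟩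
    sumᴸ (map (λ a → sumᴸ (map (λ b → χ (a , b)) (allFin N))) (allFin N))
      ≡⟨ sumᴸ-map-allFin (λ a → sumᴸ (map (λ b → χ (a , b)) (allFin N))) ⟩
    ∑[ a < N ] sumᴸ (map (λ b → χ (a , b)) (allFin N))
      ≡⟨ sum-cong-≗ (λ a → sumᴸ-map-allFin (λ b → χ (a , b))) ⟩
    ∑[ a < N ] count (λ b → orderedEdge (a , b) ∧ F (a , b))
      ∎
    where
    open ≡-Reasoning
    χ : Fin N × Fin N → ℕ
    χ p = indicator (orderedEdge p ∧ F p)

  indicator-adj : ∀ a b x →
    indicator (adj G a b ∧ x) ≡ indicator (orderedEdge (a , b) ∧ x) + indicator (orderedEdge (b , a) ∧ x)
  indicator-adj a b x with <-cmp (toℕ a) (toℕ b)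
  ... | tri< a<b _ b≮a rewrite dec-true (toℕ a <? toℕ b) a<b | dec-false (toℕ b <? toℕ a) b≮a =
    sym (+-identityʳ _)
  ... | tri> a≮b _ b<a
    rewrite dec-false (toℕ a <? toℕ b) a≮b | dec-true (toℕ b <? toℕ a) b<a | symmetric a b = refl
  ... | tri≈ _ a≡b _ rewrite toℕ-injective a≡b | irreflexive b | ∧-zeroʳ (toℕ b <ᵇ toℕ b) = refl

  count-adjacent : ∀ (F : Fin N → Fin N → Bool) →
    ∑[ a < N ] count (λ b → adj G a b ∧ F a b) ≡
    count (λ e → F (proj₁ (edge e)) (proj₂ (edge e))) + count (λ e → F (proj₂ (edge e)) (proj₁ (edge e)))
  count-adjacent F = begin
    ∑[ a < N ] count (λ b → adj G a b ∧ F a b)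
      ≡⟨ sum-cong-≗ (λ a → trans (sum-cong-≗ (λ b → indicator-adj a b (F a b))) (∑-distrib-+ _ (into a))) ⟩
    ∑[ a < N ] (sum (out a) + sum (into a))
      ≡⟨ ∑-distrib-+ (sum ∘ out) (sum ∘ into) ⟩
    ∑[ a < N ] sum (out a) + ∑[ a < N ] sum (into a)
      ≡⟨ cong (∑[ a < N ] sum (out a) +_) (∑-comm into) ⟩
    ∑[ a < N ] sum (out a) + ∑[ b < N ] ∑[ a < N ] into a b
      ≡⟨ sym (cong₂ _+_ (∑-edge (λ p → F (proj₁ p) (proj₂ p))) (∑-edge (λ p → F (proj₂ p) (proj₁ p)))) ⟩
    count (λ e → F (proj₁ (edge e)) (proj₂ (edge e))) + count (λ e → F (proj₂ (edge e)) (proj₁ (edge e)))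
      ∎
    where
    open ≡-Reasoning
    out into : Fin N → Fin N → ℕ
    out  a b = indicator (orderedEdge (a , b) ∧ F a b)
    into a b = indicator (orderedEdge (b , a) ∧ F a b)

-- Counting in C_m

infix 25 _≐_

_≐_ : ∀ {m} → Fin m → Fin m → Formula m
_≐_ = eqᶠ

-- C_m has no truth constants; any variable z provides them through a vacuous ∃^{≥0} z.
⊥ᶠ ⊤ᶠ : ∀ {m} → Fin m → Formula m
⊥ᶠ z = ¬ᶠ (∃≥ 0 z (z ≐ z))
⊤ᶠ z = ¬ᶠ (⊥ᶠ z)

constᶠ : ∀ {m} → Fin m → Bool → Formula m
constᶠ z b = if b then ⊤ᶠ z else ⊥ᶠ z

_∨ᶠ_ : ∀ {m} → Formula m → Formula m → Formula m
φ ∨ᶠ ψ = ¬ᶠ (¬ᶠ φ ∧ᶠ ¬ᶠ ψ)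

⋁≤ : ∀ {m} → (ℕ → Formula m) → ℕ → Formula m
⋁≤ f zero    = f zero
⋁≤ f (suc t) = f (suc t) ∨ᶠ ⋁≤ f t

sum≥ : ∀ {m} → Fin m → List (ℕ → Formula m) → ℕ → Formula m
sum≥ z []       zero    = ⊤ᶠ z
sum≥ z []       (suc t) = ⊥ᶠ z
sum≥ z (Q ∷ Qs) t       = ⋁≤ (λ c → Q c ∧ᶠ sum≥ z Qs (t ∸ c)) t

-- #{(a, b) : ψ} ≥ c  iff  ∑_{j<c} #{a : #{b : ψ} > j} ≥ c, as only the truncations min(#{b : ψ}, c) matter.
pairs≥ : ∀ {m} → Fin m → Fin m → Formula m → ℕ → Formula m
pairs≥ z w ψ c = sum≥ z (tabulate {n = c} (λ j d → ∃≥ d z (∃≥ (suc (toℕ j)) w ψ))) c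

module Semantics {m : ℕ} (G : Graph) where

  _[_≔_] : Assignment m G → Fin m → Fin (n G) → Assignment m G
  _[_≔_] = _[_↦_] {m = m} {G = G}

  ≔-updates : ∀ β x v → (β [ x ≔ v ]) x ≡ just v
  ≔-updates β x v rewrite dec-true (x Fin.≟ x) refl = refl

  ≔-minimal : ∀ β {x y} v → y ≢ x → (β [ x ≔ v ]) y ≡ β y
  ≔-minimal β {x} {y} v y≢x rewrite dec-false (y Fin.≟ x) y≢x = refl

  Counts : Assignment m G → (ℕ → Formula m) → ℕ → Set
  Counts β Q n = ∀ c → ⟦ Q c ⟧ G β ≡ (c ≤ᵇ n)

  ⟦constᶠ⟧ : ∀ (z : Fin m) b β → ⟦ constᶠ z b ⟧ G β ≡ b
  ⟦constᶠ⟧ z true  β = refl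
  ⟦constᶠ⟧ z false β = refl

  ⟦∨ᶠ⟧ : ∀ (φ ψ : Formula m) β → ⟦ φ ∨ᶠ ψ ⟧ G β ≡ ⟦ φ ⟧ G β ∨ ⟦ ψ ⟧ G β
  ⟦∨ᶠ⟧ φ ψ β with ⟦ φ ⟧ G β
  ... | true  = refl
  ... | false = not-involutive (⟦ ψ ⟧ G β)

  T-Counts : ∀ {β n} Q → Counts β Q n → ∀ c → T (⟦ Q c ⟧ G β) ⇔ c ≤ n
  T-Counts Q Qn c = ⇔.trans (mk⇔ (subst T (Qn c)) (subst T (sym (Qn c)))) T-≤ᵇ

  T-⋁≤ : ∀ (f : ℕ → Formula m) β t → T (⟦ ⋁≤ f t ⟧ G β) ⇔ (∃[ c ] (c ≤ t × T (⟦ f c ⟧ G β)))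
  T-⋁≤ f β t = mk⇔ (some t) (λ (c , c≤t , fc) → any t c≤t fc)
    where
    some : ∀ t → T (⟦ ⋁≤ f t ⟧ G β) → ∃[ c ] (c ≤ t × T (⟦ f c ⟧ G β))
    some zero    h = zero , z≤n , h
    some (suc t) h with to T-∨ (subst T (⟦∨ᶠ⟧ (f (suc t)) (⋁≤ f t) β) h)
    ... | inj₁ ft = suc t , ≤-refl , ft
    ... | inj₂ fs with some t fs
    ...   | c , c≤t , fc = c , m≤n⇒m≤1+n c≤t , fc
    any : ∀ t {c} → c ≤ t → T (⟦ f c ⟧ G β) → T (⟦ ⋁≤ f t ⟧ G β)
    any zero    z≤n fc = fc
    any (suc t) {c} c≤t fc =
      subst T (sym (⟦∨ᶠ⟧ (f (suc t)) (⋁≤ f t) β)) (from T-∨ (disjunct (m≤n⇒m<n∨m≡n c≤t)))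
      where
      disjunct : c < suc t ⊎ c ≡ suc t → T (⟦ f (suc t) ⟧ G β) ⊎ T (⟦ ⋁≤ f t ⟧ G β)
      disjunct (inj₁ c<1+t) = inj₂ (any t (≤-pred c<1+t) fc)
      disjunct (inj₂ refl)  = inj₁ fc

  ⟦∃≥⟧ : ∀ (x : Fin m) φ β → Counts β (λ c → ∃≥ c x φ) (count (λ v → ⟦ φ ⟧ G (β [ x ≔ v ])))
  ⟦∃≥⟧ x φ β c = cong (c ≤ᵇ_) (length-filterᵇ-tabulate (λ v → ⟦ φ ⟧ G (β [ x ≔ v ])) (λ v → v))

  ⟦sum≥⟧ : ∀ z β {Qs ns} → Pointwise (Counts β) Qs ns → Counts β (sum≥ z Qs) (sumᴸ ns)
  ⟦sum≥⟧ z β []                 zero    = refl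
  ⟦sum≥⟧ z β []                 (suc t) = refl
  ⟦sum≥⟧ z β {Q ∷ Qs} {n ∷ ns} (Qn ∷ Qsns) t = T-ext (mk⇔ split join)
    where
    rest : Counts β (sum≥ z Qs) (sumᴸ ns)
    rest = ⟦sum≥⟧ z β Qsns
    splits : ℕ → Formula m
    splits c = Q c ∧ᶠ sum≥ z Qs (t ∸ c)
    split : T (⟦ sum≥ z (Q ∷ Qs) t ⟧ G β) → T (t ≤ᵇ n + sumᴸ ns)
    split h =
      let c , c≤t , both = to (T-⋁≤ splits β t) h
          Qc , restc     = to (T-∧ {⟦ Q c ⟧ G β} {⟦ sum≥ z Qs (t ∸ c) ⟧ G β}) both
      in from T-≤ᵇ (from (≤-+⇔split t n (sumᴸ ns))
           (c , c≤t , to (T-Counts Q Qn c) Qc , to (T-Counts (sum≥ z Qs) rest (t ∸ c)) restc))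
    join : T (t ≤ᵇ n + sumᴸ ns) → T (⟦ sum≥ z (Q ∷ Qs) t ⟧ G β)
    join h =
      let c , c≤t , c≤n , t∸c≤ = to (≤-+⇔split t n (sumᴸ ns)) (to T-≤ᵇ h)
      in from (T-⋁≤ splits β t) (c , c≤t , from T-∧
           (from (T-Counts Q Qn c) c≤n , from (T-Counts (sum≥ z Qs) rest (t ∸ c)) t∸c≤))

  ⟦pairs≥⟧ : ∀ (z w : Fin m) ψ β →
    Counts β (pairs≥ z w ψ) (∑[ a < n G ] count (λ b → ⟦ ψ ⟧ G (β [ z ≔ a ] [ w ≔ b ])))
  ⟦pairs≥⟧ z w ψ β c = begin
    ⟦ pairs≥ z w ψ c ⟧ G β
      ≡⟨ ⟦sum≥⟧ z β (Pointwise.tabulate⁺ layer) c ⟩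
    (c ≤ᵇ sumᴸ (tabulate layers))
      ≡⟨ cong (c ≤ᵇ_) (trans (sumᴸ-tabulate layers) (∑-layers c f)) ⟩
    (c ≤ᵇ ∑[ a < n G ] (f a ⊓ c))
      ≡⟨ T-ext (⇔.trans T-≤ᵇ (⇔.trans (≤-∑-⊓ f c) (⇔.sym T-≤ᵇ))) ⟩
    (c ≤ᵇ sum f)
      ∎
    where
    open ≡-Reasoning
    f : Fin (n G) → ℕ
    f a = count (λ b → ⟦ ψ ⟧ G (β [ z ≔ a ] [ w ≔ b ]))
    layers : Fin c → ℕ
    layers j = count (λ a → suc (toℕ j) ≤ᵇ f a)
    layer : ∀ j → Counts β (λ d → ∃≥ d z (∃≥ (suc (toℕ j)) w ψ)) (layers j)
    layer j d = trans (⟦∃≥⟧ z (∃≥ (suc (toℕ j)) w ψ) β d)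
      (cong (d ≤ᵇ_) (sum-cong-≗ (λ a → cong indicator (⟦∃≥⟧ w ψ (β [ z ≔ a ]) (suc (toℕ j))))))

-- Free variables

record AllFree {m} (A : Fin m → Set) (φ : Formula m) : Set where
  constructor allFree
  field free⇒ : ∀ z → T (free z φ) → A z
open AllFree

module _ {m : ℕ} {A : Fin m → Set} where

  AllFree-¬ : ∀ {φ} → AllFree A φ → AllFree A (¬ᶠ φ)
  AllFree-¬ Aφ = allFree (free⇒ Aφ)

  AllFree-∧ : ∀ {φ ψ} → AllFree A φ → AllFree A ψ → AllFree A (φ ∧ᶠ ψ)
  AllFree-∧ Aφ Aψ = allFree λ z → [ free⇒ Aφ z , free⇒ Aψ z ]′ ∘ to T-∨

  AllFree-∨ : ∀ {φ ψ} → AllFree A φ → AllFree A ψ → AllFree A (φ ∨ᶠ ψ)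
  AllFree-∨ Aφ Aψ = allFree (free⇒ (AllFree-∧ Aφ Aψ))

  AllFree-⊥ᶠ : ∀ d → AllFree A (⊥ᶠ d)
  AllFree-⊥ᶠ d = allFree closed
    where
    closed : ∀ z → T (free z (⊥ᶠ d)) → A z
    closed z t with z == d
    closed z () | true
    closed z () | false

  AllFree-constᶠ : ∀ d b → AllFree A (constᶠ d b)
  AllFree-constᶠ d true  = AllFree-¬ (AllFree-⊥ᶠ d)
  AllFree-constᶠ d false = AllFree-⊥ᶠ d

  AllFree-⋁≤ : ∀ {f} → (∀ c → AllFree A (f c)) → ∀ t → AllFree A (⋁≤ f t)
  AllFree-⋁≤ Af zero    = Af zero
  AllFree-⋁≤ Af (suc t) = AllFree-∨ (Af (suc t)) (AllFree-⋁≤ Af t)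

  AllFree-sum≥ : ∀ d {Qs} → All (λ Q → ∀ c → AllFree A (Q c)) Qs → ∀ t → AllFree A (sum≥ d Qs t)
  AllFree-sum≥ d []         zero    = AllFree-¬ (AllFree-⊥ᶠ d)
  AllFree-sum≥ d []         (suc t) = AllFree-⊥ᶠ d
  AllFree-sum≥ d (AQ ∷ AQs) t       = AllFree-⋁≤ (λ c → AllFree-∧ (AQ c) (AllFree-sum≥ d AQs (t ∸ c))) t

AllFree-∃≥ : ∀ {m} {A A′ : Fin m → Set} {x φ} t → (∀ {z} → z ≢ x → A′ z → A z) →
  AllFree A′ φ → AllFree A (∃≥ t x φ)
AllFree-∃≥ t bound Aφ = allFree λ z h →
  let not-x , in-φ = to T-∧ h in bound (T-not-==⇒≢ not-x) (free⇒ Aφ z in-φ)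

AllFree-pairs≥ : ∀ {m} {A A′ : Fin m → Set} {z w ψ} → (∀ {v} → v ≢ z → v ≢ w → A′ v → A v) →
  AllFree A′ ψ → ∀ c → AllFree A (pairs≥ z w ψ c)
AllFree-pairs≥ {z = z} bound Aψ c = AllFree-sum≥ z (Allₚ.tabulate⁺ {n = c} λ j d →
  AllFree-∃≥ d (λ v≢z Av → Av v≢z) (AllFree-∃≥ (suc (toℕ j)) (λ v≢w A′v v≢z → bound v≢z v≢w A′v) Aψ)) c

AllFree-≐ : ∀ {m} {A : Fin m → Set} {z w} → A z → A w → AllFree A (z ≐ w)
AllFree-≐ {A = A} {z} {w} Az Aw = allFree λ v → [ at z Az , at w Aw ]′ ∘ to (T-∨ {v == z})
  where
  at : ∀ z {v} → A z → T (v == z) → A v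
  at z Az t = subst A (sym (to T-== t)) Az

AllFree-edge : ∀ {m} {A : Fin m → Set} {z w} → A z → A w → AllFree A (edgeᶠ z w)
AllFree-edge Az Aw = allFree (free⇒ (AllFree-≐ Az Aw))

AllFree⇒Sentence : ∀ {m} {A : Fin m → Set} {φ} → (∀ {z} → ¬ A z) → AllFree A φ → Sentence φ
AllFree⇒Sentence {φ = φ} ¬A closed x with free x φ | free⇒ closed x
... | true  | Ax = ⊥-elim (¬A (Ax _))
... | false | _  = refl

-- Subdivisions

subAdj-branch-branch : ∀ G s u u′ → subAdj G s (inj₁ u) (inj₁ u′) ≡ (s ≡ᵇ 0) ∧ adj G u u′
subAdj-branch-branch G zero    u u′ = refl
subAdj-branch-branch G (suc s) u u′ = refl

subAdj-branch-inner : ∀ G s u e j → subAdj G s (inj₁ u) (inj₂ (e , j)) ≡ endAdj G s u e j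
subAdj-branch-inner G zero    u e j = refl
subAdj-branch-inner G (suc s) u e j = refl

subAdj-inner-branch : ∀ G s u e j → subAdj G s (inj₂ (e , j)) (inj₁ u) ≡ endAdj G s u e j
subAdj-inner-branch G zero    u e j = refl
subAdj-inner-branch G (suc s) u e j = refl

subAdj-inner-inner : ∀ G s e j e′ j′ → subAdj G s (inj₂ (e , j)) (inj₂ (e′ , j′)) ≡ (e == e′) ∧ adjacentᵇ j j′
subAdj-inner-inner G zero    e j e′ j′ = refl
subAdj-inner-inner G (suc s) e j e′ j′ = refl

module Subdivision (G : Graph) (simple : IsSimple G) (s : ℕ) where
  open Edges G simple public

  Gˢ : Graph
  Gˢ = subdivision G s

  branchVertex : Fin N → Fin (n Gˢ)
  branchVertex u = u ↑ˡ (E * s)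

  innerVertex : Fin E → Fin s → Fin (n Gˢ)
  innerVertex e j = N ↑ʳ combine e j

  decode-splitAt : ∀ v → decode G s v ≡ Sum.map id (remQuot s) (splitAt N v)
  decode-splitAt v with splitAt N v
  ... | inj₁ _ = refl
  ... | inj₂ _ = refl

  decode-branch : ∀ u → decode G s (branchVertex u) ≡ inj₁ u
  decode-branch u = trans (decode-splitAt _) (cong (Sum.map id (remQuot s)) (splitAt-↑ˡ N u (E * s)))

  decode-inner : ∀ e j → decode G s (innerVertex e j) ≡ inj₂ (e , j)
  decode-inner e j = begin
    decode G s (innerVertex e j)
      ≡⟨ decode-splitAt _ ⟩
    Sum.map id (remQuot s) (splitAt N (N ↑ʳ combine e j))
      ≡⟨ cong (Sum.map id (remQuot s)) (splitAt-↑ʳ N (E * s) _) ⟩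
    inj₂ (remQuot s (combine e j))
      ≡⟨ cong inj₂ (remQuot-combine e j) ⟩
    inj₂ (e , j)
      ∎
    where open ≡-Reasoning

  branch-== : ∀ u u′ → (branchVertex u == branchVertex u′) ≡ (u == u′)
  branch-== u u′ =
    T-ext (⇔.trans T-== (⇔.trans (mk⇔ (↑ˡ-injective (E * s) u u′) (cong branchVertex)) (⇔.sym T-==)))

  branch-==-inner : ∀ u e j → (branchVertex u == innerVertex e j) ≡ false
  branch-==-inner u e j = dec-false (branchVertex u Fin.≟ innerVertex e j) (↑ˡ≢↑ʳ u (combine e j))

  inner-==-branch : ∀ u e j → (innerVertex e j == branchVertex u) ≡ false
  inner-==-branch u e j = dec-false (innerVertex e j Fin.≟ branchVertex u) (↑ˡ≢↑ʳ u (combine e j) ∘ sym)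

  T-inner-== : ∀ {e j e′ j′} → T (innerVertex e j == innerVertex e′ j′) ⇔ (e ≡ e′ × j ≡ j′)
  T-inner-== {e} {j} {e′} {j′} = ⇔.trans T-==
    (mk⇔ (combine-injective e j e′ j′ ∘ ↑ʳ-injective N _ _) (λ (e≡e′ , j≡j′) → cong₂ innerVertex e≡e′ j≡j′))

  adj-branch-branch : ∀ u u′ → adj Gˢ (branchVertex u) (branchVertex u′) ≡ (s ≡ᵇ 0) ∧ adj G u u′
  adj-branch-branch u u′ =
    trans (cong₂ (subAdj G s) (decode-branch u) (decode-branch u′)) (subAdj-branch-branch G s u u′)

  adj-branch-inner : ∀ u e j → adj Gˢ (branchVertex u) (innerVertex e j) ≡ endAdj G s u e j
  adj-branch-inner u e j =
    trans (cong₂ (subAdj G s) (decode-branch u) (decode-inner e j)) (subAdj-branch-inner G s u e j)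

  adj-inner-branch : ∀ u e j → adj Gˢ (innerVertex e j) (branchVertex u) ≡ endAdj G s u e j
  adj-inner-branch u e j =
    trans (cong₂ (subAdj G s) (decode-inner e j) (decode-branch u)) (subAdj-inner-branch G s u e j)

  T-adj-inner-inner : ∀ e j e′ j′ →
    T (adj Gˢ (innerVertex e j) (innerVertex e′ j′)) ⇔ (e ≡ e′ × Adjacent j j′)
  T-adj-inner-inner e j e′ j′ =
    subst (λ b → T b ⇔ (e ≡ e′ × Adjacent j j′)) (sym adj≡) (⇔.trans T-∧ (T-== ×-⇔ T-adjacent))
    where
    adj≡ : adj Gˢ (innerVertex e j) (innerVertex e′ j′) ≡ (e == e′) ∧ adjacentᵇ j j′
    adj≡ = trans (cong₂ (subAdj G s) (decode-inner e j) (decode-inner e′ j′))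
                 (subAdj-inner-inner G s e j e′ j′)

  -- (e , j) is the inner vertex at position i on the path from a to b, position 0 being next to a.
  data Between (a b : Fin N) (i : Fin s) (e : Fin E) (j : Fin s) : Set where
    forward  : edge e ≡ (a , b) → j ≡ i → Between a b i e j
    backward : edge e ≡ (b , a) → j ≡ opposite i → Between a b i e j

  between-flip : ∀ {a b i e j} → Between a b i e j → Between b a (opposite i) e j
  between-flip {i = i} (forward  e≡ab j≡i)  = backward e≡ab (trans j≡i (sym (opposite-involutive i)))
  between-flip         (backward e≡ba j≡ī) = forward e≡ba j≡ī

  edge-unswapped : ∀ {e e′ a b} → edge e ≡ (a , b) → edge e′ ≡ (b , a) → ⊥
  edge-unswapped {e} {e′} e≡ab e′≡ba = <-asym (ordered e≡ab) (ordered e′≡ba)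
    where
    ordered : ∀ {e a b} → edge e ≡ (a , b) → toℕ a < toℕ b
    ordered {e} e≡ab = subst (λ (a , b) → toℕ a < toℕ b) e≡ab (edge-ordered e)

  same-edge : ∀ {e a b a′ b′} → edge e ≡ (a , b) → edge e ≡ (a′ , b′) → a ≡ a′ × b ≡ b′
  same-edge e≡ab e≡a′b′ = ,-injective (trans (sym e≡ab) e≡a′b′)

  between-unique : ∀ {a b i e j e′ j′} → Between a b i e j → Between a b i e′ j′ → e ≡ e′ × j ≡ j′
  between-unique (forward  e≡ab refl) (forward  e′≡ab refl) = edge-injective (trans e≡ab (sym e′≡ab)) , refl
  between-unique (forward  e≡ab _)    (backward e′≡ba _)    = ⊥-elim (edge-unswapped e≡ab e′≡ba)
  between-unique (backward e≡ba _)    (forward  e′≡ab _)    = ⊥-elim (edge-unswapped e′≡ab e≡ba)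
  between-unique (backward e≡ba refl) (backward e′≡ba refl) = edge-injective (trans e≡ba (sym e′≡ba)) , refl

  between-ends : ∀ {a b i a′ b′ i′ e j} → Between a b i e j → Between a′ b′ i′ e j →
    (i ≡ i′ × a ≡ a′ × b ≡ b′) ⊎ (i′ ≡ opposite i × a ≡ b′ × b ≡ a′)
  between-ends (forward e≡ab refl) (forward e≡a′b′ i≡i′)
    with refl , refl ← same-edge e≡ab e≡a′b′ = inj₁ (i≡i′ , refl , refl)
  between-ends {i′ = i′} (forward e≡ab refl) (backward e≡b′a′ refl)
    with refl , refl ← same-edge e≡ab e≡b′a′ = inj₂ (sym (opposite-involutive i′) , refl , refl)
  between-ends (backward e≡ba refl) (forward e≡a′b′ ī≡i′)
    with refl , refl ← same-edge e≡ba e≡a′b′ = inj₂ (sym ī≡i′ , refl , refl)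
  between-ends (backward e≡ba refl) (backward e≡b′a′ ī≡ī′)
    with refl , refl ← same-edge e≡ba e≡b′a′ = inj₁ (opposite-injective ī≡ī′ , refl , refl)

  same-inner⇔ : ∀ {a b i e j a′ b′ i′ e′ j′} → Between a b i e j → Between a′ b′ i′ e′ j′ →
    (e ≡ e′ × j ≡ j′) ⇔ ((i ≡ i′ × a ≡ a′ × b ≡ b′) ⊎ (i′ ≡ opposite i × a ≡ b′ × b ≡ a′))
  same-inner⇔ o o′ = mk⇔ (λ { (refl , refl) → between-ends o o′ })
    [ (λ { (refl , refl , refl) → between-unique o o′ })
    , (λ { (refl , refl , refl) → between-unique (between-flip o) o′ }) ]′

  between-adjacent : ∀ {a b i e j i′ e′ j′} → Between a b i e j → Between a b i′ e′ j′ → Adjacent i i′ →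
    e ≡ e′ × Adjacent j j′
  between-adjacent (forward  e≡ab refl) (forward  e′≡ab refl) adj =
    edge-injective (trans e≡ab (sym e′≡ab)) , adj
  between-adjacent (forward  e≡ab _)    (backward e′≡ba _)    _   = ⊥-elim (edge-unswapped e≡ab e′≡ba)
  between-adjacent (backward e≡ba _)    (forward  e′≡ab _)    _   = ⊥-elim (edge-unswapped e′≡ab e≡ba)
  between-adjacent (backward e≡ba refl) (backward e′≡ba refl) adj =
    edge-injective (trans e≡ba (sym e′≡ba)) , adjacent-opposite adj

  adjacent-ends : ∀ {a b i a′ b′ i′ e j j′} → Between a b i e j → Between a′ b′ i′ e j′ → Adjacent j j′ →
    (Adjacent i i′ × a ≡ a′ × b ≡ b′) ⊎ (Adjacent (opposite i) i′ × a ≡ b′ × b ≡ a′)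
  adjacent-ends (forward e≡ab refl) (forward e≡a′b′ refl) adj
    with refl , refl ← same-edge e≡ab e≡a′b′ = inj₁ (adj , refl , refl)
  adjacent-ends (forward e≡ab refl) (backward e≡b′a′ refl) adj
    with refl , refl ← same-edge e≡ab e≡b′a′ = inj₂ (adjacent-opposite-swap adj , refl , refl)
  adjacent-ends (backward e≡ba refl) (forward e≡a′b′ refl) adj
    with refl , refl ← same-edge e≡ba e≡a′b′ = inj₂ (adj , refl , refl)
  adjacent-ends {i = i} (backward e≡ba refl) (backward e≡b′a′ refl) adj
    with refl , refl ← same-edge e≡ba e≡b′a′ =
    inj₁ (subst (λ x → Adjacent x _) (opposite-involutive i) (adjacent-opposite-swap adj) , refl , refl)

  adjacent-inner⇔ : ∀ {a b i e j a′ b′ i′ e′ j′} → Between a b i e j → Between a′ b′ i′ e′ j′ →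
    (e ≡ e′ × Adjacent j j′) ⇔
    ((Adjacent i i′ × a ≡ a′ × b ≡ b′) ⊎ (Adjacent (opposite i) i′ × a ≡ b′ × b ≡ a′))
  adjacent-inner⇔ o o′ = mk⇔ (λ { (refl , adj) → adjacent-ends o o′ adj })
    [ (λ { (adj , refl , refl) → between-adjacent o o′ adj })
    , (λ { (adj , refl , refl) → between-adjacent (between-flip o) o′ adj }) ]′

  endAdj-between : ∀ {a b i e j} → Between a b i e j → ∀ u →
    endAdj G s u e j ≡ ((toℕ i ≡ᵇ 0) ∧ (u == a)) ∨ ((suc (toℕ i) ≡ᵇ s) ∧ (u == b))
  endAdj-between (forward e≡ab refl) u rewrite e≡ab = refl
  endAdj-between {a} {b} {i} (backward e≡ba refl) u rewrite e≡ba | opposite-first i | opposite-last i =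
    ∨-comm ((suc (toℕ i) ≡ᵇ s) ∧ (u == b)) ((toℕ i ≡ᵇ 0) ∧ (u == a))

-- The translation

data Kind (s : ℕ) : Set where
  branch : Kind s
  inner  : Fin s → Kind s

record Pairing (k m : ℕ) : Set where
  field
    p q         : Fin k → Fin m
    p-injective : ∀ {x y} → p x ≡ p y → x ≡ y
    q-injective : ∀ {x y} → q x ≡ q y → x ≡ y
    p≢q         : ∀ x y → p x ≢ q y

module Translation (s : ℕ) {k m : ℕ} (pairing : Pairing k m) where
  open Pairing pairing

  Kinds : Set
  Kinds = Fin k → Maybe (Kind s)

  bind : Kinds → Fin k → Kind s → Kinds
  bind τ x κ = updateAt τ x (const (just κ))

  bind-same : ∀ τ x κ → bind τ x κ x ≡ just κ
  bind-same τ x κ = updateAt-updates x τ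

  bind-other : ∀ τ {x y} κ → y ≢ x → bind τ x κ y ≡ τ y
  bind-other τ {x} {y} κ = updateAt-minimal y x τ

  oriented : Fin k → Fin k → Bool → Bool → Formula m
  oriented x y c c′ =
    (constᶠ (p x) c  ∧ᶠ (p x ≐ p y ∧ᶠ q x ≐ q y)) ∨ᶠ
    (constᶠ (p x) c′ ∧ᶠ (p x ≐ q y ∧ᶠ q x ≐ p y))

  edgeᵀ-branch-inner : Fin k → Fin k → Fin s → Formula m
  edgeᵀ-branch-inner x y i =
    (constᶠ (p x) (toℕ i ≡ᵇ 0) ∧ᶠ p x ≐ p y) ∨ᶠ (constᶠ (p x) (suc (toℕ i) ≡ᵇ s) ∧ᶠ p x ≐ q y)

  eqᵀ : Maybe (Kind s) → Maybe (Kind s) → Fin k → Fin k → Formula m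
  eqᵀ (just branch)    (just branch)     x y = p x ≐ p y
  eqᵀ (just (inner i)) (just (inner i′)) x y = oriented x y (i == i′) (i′ == opposite i)
  eqᵀ _                _                 x y = ⊥ᶠ (p x)

  edgeᵀ : Maybe (Kind s) → Maybe (Kind s) → Fin k → Fin k → Formula m
  edgeᵀ (just branch)    (just branch)     x y = constᶠ (p x) (s ≡ᵇ 0) ∧ᶠ edgeᶠ (p x) (p y)
  edgeᵀ (just branch)    (just (inner i))  x y = edgeᵀ-branch-inner x y i
  edgeᵀ (just (inner i)) (just branch)     x y = edgeᵀ-branch-inner y x i
  edgeᵀ (just (inner i)) (just (inner i′)) x y = oriented x y (adjacentᵇ i i′) (adjacentᵇ (opposite i) i′)
  edgeᵀ _                _                 x y = ⊥ᶠ (p x)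

  branches≥ : Fin k → Formula m → ℕ → Formula m
  branches≥ x ψ c = ∃≥ c (p x) ψ

  inner≥ : Fin k → Formula m → ℕ → Formula m
  inner≥ x ψ = pairs≥ (p x) (q x) (edgeᶠ (p x) (q x) ∧ᶠ ψ)

  -- Every inner vertex is counted once per orientation of its edge, hence the doubling.
  ∃≥ᵀ : Fin k → Formula m → (Fin s → Formula m) → ℕ → Formula m
  ∃≥ᵀ x ψ ψs t = sum≥ (p x) (branches≥ x ψ ∷ branches≥ x ψ ∷ tabulate (inner≥ x ∘ ψs)) (t + t)

  translate : Kinds → Formula k → Formula m
  translate τ (eqᶠ x y)   = eqᵀ (τ x) (τ y) x y
  translate τ (edgeᶠ x y) = edgeᵀ (τ x) (τ y) x y
  translate τ (¬ᶠ φ)      = ¬ᶠ (translate τ φ)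
  translate τ (φ ∧ᶠ ψ)    = translate τ φ ∧ᶠ translate τ ψ
  translate τ (∃≥ t x φ)  =
    ∃≥ᵀ x (translate (bind τ x branch) φ) (λ i → translate (bind τ x (inner i)) φ) t

  data InUse (τ : Kinds) : Fin m → Set where
    first  : ∀ {x κ} → τ x ≡ just κ → InUse τ (p x)
    second : ∀ {x i} → τ x ≡ just (inner i) → InUse τ (q x)

  unbind : ∀ {τ x κ z} → z ≢ p x → (∀ {i} → κ ≡ inner i → z ≢ q x) → InUse (bind τ x κ) z → InUse τ z
  unbind {τ} {x} z≢px z≢qx (first {y} bound) with y Fin.≟ x
  ... | yes refl = ⊥-elim (z≢px refl)
  ... | no  y≢x  = first (trans (sym (bind-other τ _ y≢x)) bound)
  unbind {τ} {x} z≢px z≢qx (second {y} bound) with y Fin.≟ x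
  ... | yes refl = ⊥-elim (z≢qx (just-injective (trans (sym (bind-same τ x _)) bound)) refl)
  ... | no  y≢x  = second (trans (sym (bind-other τ _ y≢x)) bound)

  AllFree-oriented : ∀ {τ x y i i′ c c′} → τ x ≡ just (inner i) → τ y ≡ just (inner i′) →
    AllFree (InUse τ) (oriented x y c c′)
  AllFree-oriented τx τy = AllFree-∨
    (AllFree-∧ (AllFree-constᶠ _ _) (AllFree-∧ (AllFree-≐ px py) (AllFree-≐ qx qy)))
    (AllFree-∧ (AllFree-constᶠ _ _) (AllFree-∧ (AllFree-≐ px qy) (AllFree-≐ qx py)))
    where
    px = first τx
    qx = second τx
    py = first τy
    qy = second τy

  AllFree-edgeᵀ-branch-inner : ∀ {τ x y κ i} → τ x ≡ just κ → τ y ≡ just (inner i) →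
    AllFree (InUse τ) (edgeᵀ-branch-inner x y i)
  AllFree-edgeᵀ-branch-inner τx τy =
    AllFree-∨ (AllFree-∧ (AllFree-constᶠ _ _) (AllFree-≐ (first τx) (first τy)))
              (AllFree-∧ (AllFree-constᶠ _ _) (AllFree-≐ (first τx) (second τy)))

  AllFree-eqᵀ : ∀ {τ κx κy x y} → τ x ≡ κx → τ y ≡ κy → AllFree (InUse τ) (eqᵀ κx κy x y)
  AllFree-eqᵀ {κx = nothing}                          _  _  = AllFree-⊥ᶠ _
  AllFree-eqᵀ {κx = just branch}    {nothing}         _  _  = AllFree-⊥ᶠ _
  AllFree-eqᵀ {κx = just branch}    {just branch}     τx τy = AllFree-≐ (first τx) (first τy)
  AllFree-eqᵀ {κx = just branch}    {just (inner _)}  _  _  = AllFree-⊥ᶠ _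
  AllFree-eqᵀ {κx = just (inner _)} {nothing}         _  _  = AllFree-⊥ᶠ _
  AllFree-eqᵀ {κx = just (inner _)} {just branch}     _  _  = AllFree-⊥ᶠ _
  AllFree-eqᵀ {κx = just (inner _)} {just (inner _)}  τx τy = AllFree-oriented τx τy

  AllFree-edgeᵀ : ∀ {τ κx κy x y} → τ x ≡ κx → τ y ≡ κy → AllFree (InUse τ) (edgeᵀ κx κy x y)
  AllFree-edgeᵀ {κx = nothing}                          _  _  = AllFree-⊥ᶠ _
  AllFree-edgeᵀ {κx = just branch}    {nothing}         _  _  = AllFree-⊥ᶠ _
  AllFree-edgeᵀ {κx = just branch}    {just branch}     τx τy =
    AllFree-∧ (AllFree-constᶠ _ _) (AllFree-edge (first τx) (first τy))
  AllFree-edgeᵀ {κx = just branch}    {just (inner _)}  τx τy = AllFree-edgeᵀ-branch-inner τx τy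
  AllFree-edgeᵀ {κx = just (inner _)} {nothing}         _  _  = AllFree-⊥ᶠ _
  AllFree-edgeᵀ {κx = just (inner _)} {just branch}     τx τy = AllFree-edgeᵀ-branch-inner τy τx
  AllFree-edgeᵀ {κx = just (inner _)} {just (inner _)}  τx τy = AllFree-oriented τx τy

  AllFree-∃≥ᵀ : ∀ {τ x ψ ψs} → AllFree (InUse (bind τ x branch)) ψ →
    (∀ i → AllFree (InUse (bind τ x (inner i))) (ψs i)) → ∀ t → AllFree (InUse τ) (∃≥ᵀ x ψ ψs t)
  AllFree-∃≥ᵀ {τ} {x} Aψ Aψs t =
    AllFree-sum≥ (p x) (branches ∷ branches ∷ Allₚ.tabulate⁺ inners) (t + t)
    where
    branches : ∀ c → AllFree (InUse τ) (branches≥ x _ c)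
    branches c = AllFree-∃≥ c (λ z≢px → unbind z≢px λ ()) Aψ
    inners : ∀ i c → AllFree (InUse τ) (inner≥ x _ c)
    inners i = AllFree-pairs≥ (λ z≢px z≢qx → unbind z≢px (λ _ → z≢qx))
      (AllFree-∧ (AllFree-edge (first (bind-same τ x (inner i))) (second (bind-same τ x (inner i)))) (Aψs i))

  AllFree-translate : ∀ φ τ → AllFree (InUse τ) (translate τ φ)
  AllFree-translate (eqᶠ x y)   τ = AllFree-eqᵀ refl refl
  AllFree-translate (edgeᶠ x y) τ = AllFree-edgeᵀ refl refl
  AllFree-translate (¬ᶠ φ)      τ = AllFree-¬ (AllFree-translate φ τ)
  AllFree-translate (φ ∧ᶠ ψ)    τ = AllFree-∧ (AllFree-translate φ τ) (AllFree-translate ψ τ)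
  AllFree-translate (∃≥ t x φ)  τ = AllFree-∃≥ᵀ (AllFree-translate φ _) (λ i → AllFree-translate φ _) t

  unassigned : Kinds
  unassigned _ = nothing

  translate-sentence : ∀ φ → Sentence (translate unassigned φ)
  translate-sentence φ = AllFree⇒Sentence (λ { (first ()) ; (second ()) }) (AllFree-translate φ unassigned)

module Correctness (G : Graph) (simple : IsSimple G) (s : ℕ) {k m : ℕ} (pairing : Pairing k m) where
  open Subdivision G simple s
  open Translation s pairing
  open Pairing pairing
  open Semantics {m} G
  open Semantics {k} Gˢ using () renaming (_[_≔_] to _[_≔_]ˢ; ⟦∃≥⟧ to ⟦∃≥⟧ˢ)

  -- How the values ma, mb of p x and q x in G encode the value v of x in Gˢ, given the kind of x.
  data Represents : Maybe (Kind s) → Maybe (Fin (n Gˢ)) → Maybe (Fin N) → Maybe (Fin N) → Set where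
    unbound : ∀ {ma mb} → Represents nothing nothing ma mb
    branch  : ∀ {u ma mb} → ma ≡ just u → Represents (just branch) (just (branchVertex u)) ma mb
    inner   : ∀ {a b i e j ma mb} → ma ≡ just a → mb ≡ just b → Between a b i e j →
              Represents (just (inner i)) (just (innerVertex e j)) ma mb

  record Encodes (τ : Kinds) (α : Assignment k Gˢ) (β : Assignment m G) : Set where
    constructor encodes
    field represents : ∀ x → Represents (τ x) (α x) (β (p x)) (β (q x))
  open Encodes

  encodes-branch : ∀ {τ α β} → Encodes τ α β → ∀ x u →
    Encodes (bind τ x branch) (α [ x ≔ branchVertex u ]ˢ) (β [ p x ≔ u ])
  encodes-branch {τ} {α} {β} ρ x u = encodes represents′
    where
    α′ : Assignment k Gˢ
    α′ = α [ x ≔ branchVertex u ]ˢ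
    β′ : Assignment m G
    β′ = β [ p x ≔ u ]
    represents′ : ∀ y → Represents (bind τ x branch y) (α′ y) (β′ (p y)) (β′ (q y))
    represents′ y with y Fin.≟ x
    ... | yes refl rewrite bind-same τ x branch = branch (≔-updates β (p x) u)
    ... | no  y≢x  rewrite bind-other τ branch y≢x
                         | ≔-minimal β u (y≢x ∘ p-injective)
                         | ≔-minimal β u (p≢q x y ∘ sym) = represents ρ y

  encodes-inner : ∀ {τ α β} → Encodes τ α β → ∀ x {a b i e j} → Between a b i e j →
    Encodes (bind τ x (inner i)) (α [ x ≔ innerVertex e j ]ˢ) (β [ p x ≔ a ] [ q x ≔ b ])
  encodes-inner {τ} {α} {β} ρ x {a} {b} {i} {e} {j} o = encodes represents′
    where
    α′ : Assignment k Gˢ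
    α′ = α [ x ≔ innerVertex e j ]ˢ
    β′ : Assignment m G
    β′ = β [ p x ≔ a ] [ q x ≔ b ]
    represents′ : ∀ y → Represents (bind τ x (inner i) y) (α′ y) (β′ (p y)) (β′ (q y))
    represents′ y with y Fin.≟ x
    ... | yes refl rewrite bind-same τ x (inner i) =
      inner (trans (≔-minimal (β [ p x ≔ a ]) b (p≢q x x)) (≔-updates β (p x) a))
            (≔-updates (β [ p x ≔ a ]) (q x) b) o
    ... | no  y≢x  rewrite bind-other τ (inner i) y≢x | ≔-minimal (β [ p x ≔ a ]) b (p≢q y x)
                         | ≔-minimal β a (y≢x ∘ p-injective)
                         | ≔-minimal (β [ p x ≔ a ]) b (y≢x ∘ q-injective)
                         | ≔-minimal β a (p≢q x y ∘ sym) = represents ρ y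

  ⟦oriented⟧ : ∀ x y c c′ β → ⟦ oriented x y c c′ ⟧ G β ≡
    (c  ∧ (eqM (β (p x)) (β (p y)) ∧ eqM (β (q x)) (β (q y)))) ∨
    (c′ ∧ (eqM (β (p x)) (β (q y)) ∧ eqM (β (q x)) (β (p y))))
  ⟦oriented⟧ x y c c′ β
    rewrite ⟦∨ᶠ⟧ (constᶠ (p x) c ∧ᶠ (p x ≐ p y ∧ᶠ q x ≐ q y)) (constᶠ (p x) c′ ∧ᶠ (p x ≐ q y ∧ᶠ q x ≐ p y)) β
          | ⟦constᶠ⟧ (p x) c β | ⟦constᶠ⟧ (p x) c′ β = refl

  ⟦edgeᵀ-branch-inner⟧ : ∀ x y i β → ⟦ edgeᵀ-branch-inner x y i ⟧ G β ≡
    ((toℕ i ≡ᵇ 0) ∧ eqM (β (p x)) (β (p y))) ∨ ((suc (toℕ i) ≡ᵇ s) ∧ eqM (β (p x)) (β (q y)))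
  ⟦edgeᵀ-branch-inner⟧ x y i β
    rewrite ⟦∨ᶠ⟧ (constᶠ (p x) (toℕ i ≡ᵇ 0) ∧ᶠ p x ≐ p y) (constᶠ (p x) (suc (toℕ i) ≡ᵇ s) ∧ᶠ p x ≐ q y) β
          | ⟦constᶠ⟧ (p x) (toℕ i ≡ᵇ 0) β | ⟦constᶠ⟧ (p x) (suc (toℕ i) ≡ᵇ s) β = refl

  eqᵀ-correct : ∀ {κx κy vx vy} x y β →
    Represents κx vx (β (p x)) (β (q x)) → Represents κy vy (β (p y)) (β (q y)) →
    ⟦ eqᵀ κx κy x y ⟧ G β ≡ eqM vx vy
  eqᵀ-correct x y β unbound               _           = refl
  eqᵀ-correct x y β (branch _)            unbound     = refl
  eqᵀ-correct x y β (inner _ _ _)         unbound     = refl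
  eqᵀ-correct x y β (branch {u} px)       (branch {u′} py) rewrite px | py = sym (branch-== u u′)
  eqᵀ-correct x y β (branch {u} _)        (inner {e = e} {j} _ _ _) = sym (branch-==-inner u e j)
  eqᵀ-correct x y β (inner {e = e} {j} _ _ _) (branch {u} _) = sym (inner-==-branch u e j)
  eqᵀ-correct x y β (inner {i = i} {e} {j} px qx o) (inner {i = i′} {e′} {j′} py qy o′)
    rewrite ⟦oriented⟧ x y (i == i′) (i′ == opposite i) β | px | qx | py | qy =
    T-ext (⇔.trans (T-oriented T-== T-==) (⇔.trans (⇔.sym (same-inner⇔ o o′)) (⇔.sym T-inner-==)))

  edgeᵀ-correct : ∀ {κx κy vx vy} x y β →
    Represents κx vx (β (p x)) (β (q x)) → Represents κy vy (β (p y)) (β (q y)) →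
    ⟦ edgeᵀ κx κy x y ⟧ G β ≡ adjM Gˢ vx vy
  edgeᵀ-correct x y β unbound               _           = refl
  edgeᵀ-correct x y β (branch _)            unbound     = refl
  edgeᵀ-correct x y β (inner _ _ _)         unbound     = refl
  edgeᵀ-correct x y β (branch {u} px)       (branch {u′} py) rewrite ⟦constᶠ⟧ (p x) (s ≡ᵇ 0) β | px | py =
    sym (adj-branch-branch u u′)
  edgeᵀ-correct {just branch} {just (inner i)} x y β (branch {u} px) (inner {e = e} {j} py qy o)
    rewrite ⟦edgeᵀ-branch-inner⟧ x y i β | px | py | qy =
    sym (trans (adj-branch-inner u e j) (endAdj-between o u))
  edgeᵀ-correct {just (inner i)} {just branch} x y β (inner {e = e} {j} px qx o) (branch {u} py)
    rewrite ⟦edgeᵀ-branch-inner⟧ y x i β | px | qx | py =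
    sym (trans (adj-inner-branch u e j) (endAdj-between o u))
  edgeᵀ-correct x y β (inner {i = i} {e} {j} px qx o) (inner {i = i′} {e′} {j′} py qy o′)
    rewrite ⟦oriented⟧ x y (adjacentᵇ i i′) (adjacentᵇ (opposite i) i′) β | px | qx | py | qy =
    T-ext (⇔.trans (T-oriented T-adjacent T-adjacent)
                   (⇔.trans (⇔.sym (adjacent-inner⇔ o o′)) (⇔.sym (T-adj-inner-inner e j e′ j′))))

  module ∃≥ᵀ-correct {τ α β} (ρ : Encodes τ α β) (x : Fin k) (φ : Formula k)
    (IH : ∀ {τ′ α′ β′} → Encodes τ′ α′ β′ → ⟦ translate τ′ φ ⟧ G β′ ≡ ⟦ φ ⟧ Gˢ α′) where

    ψ : Formula m
    ψ = translate (bind τ x branch) φ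

    ψs : Fin s → Formula m
    ψs i = translate (bind τ x (inner i)) φ

    h : Fin (n Gˢ) → ℕ
    h v = indicator (⟦ φ ⟧ Gˢ (α [ x ≔ v ]ˢ))

    B X : ℕ
    B = ∑[ u < N ] h (branchVertex u)
    X = ∑[ e < E ] ∑[ j < s ] h (innerVertex e j)

    pairs : Fin s → ℕ
    pairs i = ∑[ a < N ] count (λ b → ⟦ edgeᶠ (p x) (q x) ∧ᶠ ψs i ⟧ G (β [ p x ≔ a ] [ q x ≔ b ]))

    branch-count : count (λ u → ⟦ ψ ⟧ G (β [ p x ≔ u ])) ≡ B
    branch-count = sum-cong-≗ (λ u → cong indicator (IH (encodes-branch ρ x u)))

    pairs-count : ∀ i → pairs i ≡ ∑[ e < E ] h (innerVertex e i) + ∑[ e < E ] h (innerVertex e (opposite i))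
    pairs-count i = begin
      pairs i
        ≡⟨ sum-cong-≗ (λ a → sum-cong-≗ (λ b → cong (λ c → indicator (c ∧ F a b)) (edge-value a b))) ⟩
      ∑[ a < N ] count (λ b → adj G a b ∧ F a b)
        ≡⟨ count-adjacent F ⟩
      count (λ e → F (proj₁ (edge e)) (proj₂ (edge e))) + count (λ e → F (proj₂ (edge e)) (proj₁ (edge e)))
        ≡⟨ cong₂ _+_ (sum-cong-≗ (λ e → along {e = e} (forward refl refl)))
                     (sum-cong-≗ (λ e → along {e = e} (backward refl refl))) ⟩
      ∑[ e < E ] h (innerVertex e i) + ∑[ e < E ] h (innerVertex e (opposite i))
        ∎
      where
      open ≡-Reasoning
      F : Fin N → Fin N → Bool
      F a b = ⟦ ψs i ⟧ G (β [ p x ≔ a ] [ q x ≔ b ])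
      along : ∀ {a b e j} → Between a b i e j → indicator (F a b) ≡ h (innerVertex e j)
      along o = cong indicator (IH (encodes-inner ρ x o))
      edge-value : ∀ a b → ⟦ edgeᶠ (p x) (q x) ⟧ G (β [ p x ≔ a ] [ q x ≔ b ]) ≡ adj G a b
      edge-value a b = cong₂ (adjM G) (trans (≔-minimal (β [ p x ≔ a ]) b (p≢q x x)) (≔-updates β (p x) a))
                                      (≔-updates (β [ p x ≔ a ]) (q x) b)

    pairs-total : sumᴸ (tabulate pairs) ≡ X + X
    pairs-total = begin
      sumᴸ (tabulate pairs)                     ≡⟨ sumᴸ-tabulate pairs ⟩
      sum pairs                                 ≡⟨ sum-cong-≗ pairs-count ⟩
      ∑[ i < s ] (A i + A (opposite i))         ≡⟨ ∑-distrib-+ A (A ∘ opposite) ⟩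
      sum A + ∑[ i < s ] A (opposite i)         ≡⟨ cong (sum A +_) (∑-opposite A) ⟩
      sum A + sum A                             ≡⟨ cong₂ _+_ A-total A-total ⟩
      X + X                                     ∎
      where
      open ≡-Reasoning
      A : Fin s → ℕ
      A i = ∑[ e < E ] h (innerVertex e i)
      A-total : sum A ≡ X
      A-total = ∑-comm (λ i e → h (innerVertex e i))

    vertex-count : count (λ v → ⟦ φ ⟧ Gˢ (α [ x ≔ v ]ˢ)) ≡ B + X
    vertex-count = trans (∑-↑ N h) (cong (B +_) (∑-combine E (λ y → h (N ↑ʳ y))))

    correct : ∀ t → ⟦ ∃≥ᵀ x ψ ψs t ⟧ G β ≡ ⟦ ∃≥ t x φ ⟧ Gˢ α
    correct t = begin
      ⟦ ∃≥ᵀ x ψ ψs t ⟧ G β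
        ≡⟨ ⟦sum≥⟧ (p x) β (⟦∃≥⟧ (p x) ψ β ∷ ⟦∃≥⟧ (p x) ψ β ∷ Pointwise.tabulate⁺ inner-counts) (t + t) ⟩
      (t + t ≤ᵇ nb + (nb + sumᴸ (tabulate pairs)))
        ≡⟨ cong₂ (λ b c → t + t ≤ᵇ b + (b + c)) branch-count pairs-total ⟩
      (t + t ≤ᵇ B + (B + (X + X)))
        ≡⟨ cong (t + t ≤ᵇ_) (trans (sym (+-assoc B B (X + X))) (interchange B B X X)) ⟩
      (t + t ≤ᵇ (B + X) + (B + X))
        ≡⟨ ≤ᵇ-double t (B + X) ⟩
      (t ≤ᵇ B + X)
        ≡⟨ sym (trans (⟦∃≥⟧ˢ x φ α t) (cong (t ≤ᵇ_) vertex-count)) ⟩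
      ⟦ ∃≥ t x φ ⟧ Gˢ α
        ∎
      where
      open ≡-Reasoning
      nb : ℕ
      nb = count (λ u → ⟦ ψ ⟧ G (β [ p x ≔ u ]))
      inner-counts : ∀ i → Counts β (inner≥ x (ψs i)) (pairs i)
      inner-counts i = ⟦pairs≥⟧ (p x) (q x) (edgeᶠ (p x) (q x) ∧ᶠ ψs i) β

  translate-correct : ∀ φ {τ α β} → Encodes τ α β → ⟦ translate τ φ ⟧ G β ≡ ⟦ φ ⟧ Gˢ α
  translate-correct (eqᶠ x y)   {β = β} ρ = eqᵀ-correct x y β (represents ρ x) (represents ρ y)
  translate-correct (edgeᶠ x y) {β = β} ρ = edgeᵀ-correct x y β (represents ρ x) (represents ρ y)
  translate-correct (¬ᶠ φ)      ρ = cong not (translate-correct φ ρ)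
  translate-correct (φ ∧ᶠ ψ)    ρ = cong₂ _∧_ (translate-correct φ ρ) (translate-correct ψ ρ)
  translate-correct (∃≥ t x φ)  ρ = ∃≥ᵀ-correct.correct ρ x φ (translate-correct φ) t

  ⊨-translate : ∀ φ → (G ⊨ translate unassigned φ) ≡ (Gˢ ⊨ φ)
  ⊨-translate φ = translate-correct φ (encodes (λ _ → unbound))

↑-pairing : ∀ {k} m → Pairing k (k + (k + m))
↑-pairing {k} m = record
  { p           = _↑ˡ (k + m)
  ; q           = λ x → k ↑ʳ (x ↑ˡ m)
  ; p-injective = ↑ˡ-injective (k + m) _ _
  ; q-injective = ↑ˡ-injective m _ _ ∘ ↑ʳ-injective k _ _
  ; p≢q         = λ x y → ↑ˡ≢↑ʳ x (y ↑ˡ m)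
  }

C-equiv-subdivision : ∀ {k m} → Pairing k m → ∀ s (G H : Graph) → IsSimple G → IsSimple H →
  C-equiv m G H → C-equiv k (subdivision G s) (subdivision H s)
C-equiv-subdivision pairing s G H simpleG simpleH G≡H φ _ = begin
  subdivision G s ⊨ φ         ≡⟨ sym (Correctness.⊨-translate G simpleG s pairing φ) ⟩
  G ⊨ translate unassigned φ  ≡⟨ G≡H (translate unassigned φ) (translate-sentence φ) ⟩
  H ⊨ translate unassigned φ  ≡⟨ Correctness.⊨-translate H simpleH s pairing φ ⟩
  subdivision H s ⊨ φ         ∎
  where
  open ≡-Reasoning
  open Translation s pairing

-- 8 * k unfolds definitionally to k + (k + 6 * k).
corollary3p5 : (s k : ℕ) (G H : Graph) → IsSimple G → IsSimple H →
    C-equiv (8 * k) G H → C-equiv k (subdivision G s) (subdivision H s)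
corollary3p5 s k = C-equiv-subdivision (↑-pairing (6 * k)) s
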